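{- Let $S_0=\{1,2,3,\dots\}$ and, for $n\ge 1$, construct $S_n$ from $S_{n-1}$ by the model sieve described in the context, producing the least elements $x_1,x_2,\dots$. For every $n\ge 1$, the set $S_n$ is periodic with period $P_n=\prod_{i=1}^n x_i$; that is, for every positive integer $s$, one has $s\in S_n$ if and only if $s+P_n\in S_n$.
   Context: The "model" sieve (a counting variant of the Sieve of Eratosthenes) is defined as follows. Let $S_0$ be the set of all positive integers. For $n\ge 1$, list the (infinite) set $S_{n-1}$ in increasing order as $b_1<b_2<b_3<\cdots$; note $b_1=1$, which is never removed. Put $x_n:=b_2$, the smallest element of $S_{n-1}$ different from $1$. Then $S_n:=S_{n-1}\setminus\{b_k : k\equiv 2 \pmod{x_n}\}$, i.e. stage $n$ removes $x_n$ itself and then every $x_n$-th element of $S_{n-1}$ after it. (For example $x_1=2,x_2=3,x_3=5,x_4=7,x_5=11$, and $S_3$ begins $1,7,11,13,17,23,25,29,31,37,\dots$.) Write $P_n=\prod_{i=1}^n x_i$. -}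

module Defs where

open import Data.Nat using (ℕ; zero; suc; _+_; _*_; _∸_; _≤_; _<_)
open import Data.Nat.Divisibility using (_∣?_)
open import Data.Bool using (Bool; true; false; not; _∧_; if_then_else_)
open import Relation.Nullary.Decidable using (⌊_⌋)
open import Relation.Binary.PropositionalEquality using (_≡_; _≢_)

-- A subset of the positive integers, given by its (decidable) membership function.
Subset : Set
Subset = ℕ → Bool

S₀ : Subset
S₀ zero    = false
S₀ (suc _) = true

-- rank S m = #{ k : 1 ≤ k ≤ m , k ∈ S }.
-- For b ∈ S this is the index k with b = b_k in the increasing listing of S.
rank : Subset → ℕ → ℕ
rank S zero    = 0
rank S (suc m) = (if S (suc m) then 1 else 0) + rank S m

-- "k ≡ 2 (mod x)" for an index k ≥ 1 with x ≥ 2, i.e. k = 2 + j*x for some j ≥ 0.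
removedIndex : ℕ → ℕ → Bool
removedIndex x k = ⌊ 2 Data.Nat.≤? k ⌋ ∧ ⌊ x ∣? (k ∸ 2) ⌋

-- One stage of the model sieve with sieving number x:
-- remove b_k from S whenever k ≡ 2 (mod x).
sieveStep : Subset → ℕ → Subset
sieveStep S x s = S s ∧ not (removedIndex x (rank S s))

IsLeastNonOne : Subset → ℕ → Set
IsLeastNonOne S x = (S x ≡ true) × (x ≢ 1) × (∀ y → y < x → y ≢ 1 → S y ≡ false)
  where open import Data.Product using (_×_)

-- The model sieve: S n is the set S_n and x n is x_n (x 0 is unused).
record ModelSieve (S : ℕ → Subset) (x : ℕ → ℕ) : Set where
  field
    base  : ∀ s → S 0 s ≡ S₀ s
    least : ∀ n → IsLeastNonOne (S n) (x (suc n))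
    step  : ∀ n s → S (suc n) s ≡ sieveStep (S n) (x (suc n)) s

P : (ℕ → ℕ) → ℕ → ℕ
P x zero    = 1
P x (suc n) = P x n * x (suc n)

{-# OPTIONS --safe #-}
-- If T has period Q on the positive integers, the rank of s + m Q is rank s + m · rank Q.
-- A sieve stage with number X decides membership of s from T s and the residue of its
-- rank modulo X, and shifting s by X Q changes neither; so the sieved set has period X Q.
-- Induction from S₀, which has period 1, gives period Pₙ for Sₙ.
module Submission where

open import Defs
open import Data.Nat using (ℕ; zero; suc; _+_; _*_; _∸_; _≤_; z≤n; s≤s)
open import Data.Nat.Properties
  using (≤-trans; m≤m+n; m≤n+m; +-assoc; +-comm; +-identityʳ; *-identityʳ; *-comm; +-∸-comm; n≮n)
open import Data.Nat.Divisibility using (_∣_; _∣?_; ∣m∣n⇒∣m+n; ∣m+n∣m⇒∣n; m∣m*n; ∣⇒≤)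
open import Data.Bool using (true; false; not; _∧_)
open import Data.Product using (_,_)
open import Function.Bundles using (_⇔_; mk⇔)
open import Relation.Nullary using (Dec; yes; no; contradiction)
open import Relation.Nullary.Decidable using (⌊_⌋; isYes≗does; does-⇔)
open import Relation.Binary.PropositionalEquality
  using (_≡_; refl; sym; trans; cong; subst; module ≡-Reasoning)

Periodic : Subset → ℕ → Set
Periodic T Q = ∀ s → 1 ≤ s → T s ≡ T (s + Q)

module _ {T : Subset} {Q : ℕ} (per : Periodic T Q) where

  periodic-* : ∀ m → Periodic T (m * Q)
  periodic-* zero    s _  = cong T (sym (+-identityʳ s))
  periodic-* (suc m) s hs =
    trans (per s hs)
      (trans (periodic-* m (s + Q) (≤-trans hs (m≤m+n s Q)))
        (cong T (+-assoc s Q (m * Q))))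

  rank-+ : ∀ s → rank T (s + Q) ≡ rank T s + rank T Q
  rank-+ zero    = refl
  rank-+ (suc s) rewrite sym (per (suc s) (s≤s z≤n)) | rank-+ s =
    sym (+-assoc _ (rank T s) (rank T Q))

  rank-+-* : ∀ m s → rank T (s + m * Q) ≡ rank T s + m * rank T Q
  rank-+-* zero    s = trans (cong (rank T) (+-identityʳ s)) (sym (+-identityʳ (rank T s)))
  rank-+-* (suc m) s = begin
    rank T (s + (Q + m * Q))             ≡⟨ cong (rank T) (sym (+-assoc s Q (m * Q))) ⟩
    rank T (s + Q + m * Q)               ≡⟨ rank-+-* m (s + Q) ⟩
    rank T (s + Q) + m * rank T Q        ≡⟨ cong (_+ m * rank T Q) (rank-+ s) ⟩
    rank T s + rank T Q + m * rank T Q   ≡⟨ +-assoc (rank T s) (rank T Q) (m * rank T Q) ⟩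
    rank T s + (rank T Q + m * rank T Q) ∎
    where open ≡-Reasoning

rank-positive : ∀ {T s} → 1 ≤ s → T s ≡ true → 1 ≤ rank T s
rank-positive {s = suc _} _ Ts rewrite Ts = s≤s z≤n

⌊⌋-⇔ : ∀ {A B : Set} → A ⇔ B → (a? : Dec A) (b? : Dec B) → ⌊ a? ⌋ ≡ ⌊ b? ⌋
⌊⌋-⇔ A⇔B a? b? = trans (isYes≗does a?) (trans (does-⇔ A⇔B a? b?) (sym (isYes≗does b?)))

∣⇔∣+* : ∀ {d} m n → d ∣ m ⇔ d ∣ m + d * n
∣⇔∣+* {d} m n = mk⇔
  (λ d∣m → ∣m∣n⇒∣m+n d∣m (m∣m*n n))
  (λ d∣m+dn → ∣m+n∣m⇒∣n (subst (d ∣_) (+-comm m (d * n)) d∣m+dn) (m∣m*n n))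

⌊∣?⌋-+-* : ∀ d m n → ⌊ d ∣? m ⌋ ≡ ⌊ d ∣? m + d * n ⌋
⌊∣?⌋-+-* d m n = ⌊⌋-⇔ (∣⇔∣+* m n) (d ∣? m) (d ∣? m + d * n)

-- Unlike k ∸ 2, the index k + X ∸ 2 is never truncated when k ≥ 1, so it is exactly
-- periodic in k with period X.
removedIndex≡⌊∣?⌋ : ∀ {X k} → 2 ≤ X → 1 ≤ k → removedIndex X k ≡ ⌊ X ∣? k + X ∸ 2 ⌋
removedIndex≡⌊∣?⌋ {k = zero}                   _          ()
removedIndex≡⌊∣?⌋ {zero}         {suc zero}    ()         _
removedIndex≡⌊∣?⌋ {suc zero}     {suc zero}    (s≤s ())   _
removedIndex≡⌊∣?⌋ {suc (suc y)} {suc zero}    _ _ with suc (suc y) ∣? suc y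
... | yes X∣X-1 = contradiction (∣⇒≤ X∣X-1) (n≮n (suc y))
... | no  _     = refl
removedIndex≡⌊∣?⌋ {X}            {suc (suc j)} _ _ =
  trans (⌊∣?⌋-+-* X j 1) (cong (λ m → ⌊ X ∣? j + m ⌋) (*-identityʳ X))

removedIndex-+-* : ∀ {X k} → 2 ≤ X → 1 ≤ k → ∀ c → removedIndex X (k + X * c) ≡ removedIndex X k
removedIndex-+-* {X} {k} 2≤X 1≤k c = begin
  removedIndex X (k + X * c)     ≡⟨ removedIndex≡⌊∣?⌋ 2≤X (≤-trans 1≤k (m≤m+n k (X * c))) ⟩
  ⌊ X ∣? k + X * c + X ∸ 2 ⌋     ≡⟨ cong (λ m → ⌊ X ∣? m ⌋) shift ⟩
  ⌊ X ∣? (k + X ∸ 2) + X * c ⌋   ≡⟨ sym (⌊∣?⌋-+-* X (k + X ∸ 2) c) ⟩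
  ⌊ X ∣? k + X ∸ 2 ⌋             ≡⟨ sym (removedIndex≡⌊∣?⌋ 2≤X 1≤k) ⟩
  removedIndex X k               ∎
  where
  open ≡-Reasoning
  shift : k + X * c + X ∸ 2 ≡ k + X ∸ 2 + X * c
  shift = begin
    k + X * c + X ∸ 2   ≡⟨ cong (_∸ 2) (+-assoc k (X * c) X) ⟩
    k + (X * c + X) ∸ 2 ≡⟨ cong (λ m → k + m ∸ 2) (+-comm (X * c) X) ⟩
    k + (X + X * c) ∸ 2 ≡⟨ cong (_∸ 2) (sym (+-assoc k X (X * c))) ⟩
    k + X + X * c ∸ 2   ≡⟨ +-∸-comm (X * c) (≤-trans 2≤X (m≤n+m X k)) ⟩
    k + X ∸ 2 + X * c   ∎

∧-cong-when-true : ∀ b {c c′} → (b ≡ true → c ≡ c′) → b ∧ c ≡ b ∧ c′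
∧-cong-when-true false _ = refl
∧-cong-when-true true  f = f refl

sieveStep-periodic : ∀ {T Q X} → Periodic T Q → 2 ≤ X → Periodic (sieveStep T X) (X * Q)
sieveStep-periodic {T} {Q} {X} per 2≤X s 1≤s = begin
  T s ∧ not (removedIndex X (rank T s))
    ≡⟨ ∧-cong-when-true (T s) (λ Ts → cong not (sym (removed-shift Ts))) ⟩
  T s ∧ not (removedIndex X (rank T (s + X * Q)))
    ≡⟨ cong (_∧ not (removedIndex X (rank T (s + X * Q)))) (periodic-* per X s 1≤s) ⟩
  T (s + X * Q) ∧ not (removedIndex X (rank T (s + X * Q)))
    ∎
  where
  open ≡-Reasoning
  removed-shift : T s ≡ true → removedIndex X (rank T (s + X * Q)) ≡ removedIndex X (rank T s)
  removed-shift Ts = trans (cong (removedIndex X) (rank-+-* per X s))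
                           (removedIndex-+-* 2≤X (rank-positive 1≤s Ts) (rank T Q))

least-≥2 : ∀ {T X} → T 0 ≡ false → IsLeastNonOne T X → 2 ≤ X
least-≥2 {X = zero}        T0≡false (T0≡true , _) = contradiction (trans (sym T0≡false) T0≡true) λ ()
least-≥2 {X = suc zero}    _        (_ , X≢1 , _)   = contradiction refl X≢1
least-≥2 {X = suc (suc _)} _        _               = s≤s (s≤s z≤n)

module _ {S : ℕ → Subset} {x : ℕ → ℕ} (M : ModelSieve S x) where
  open ModelSieve M

  S-zero : ∀ n → S n 0 ≡ false
  S-zero zero    = base 0
  S-zero (suc n) rewrite step n 0 | S-zero n = refl

  x-≥2 : ∀ n → 2 ≤ x (suc n)
  x-≥2 n = least-≥2 (S-zero n) (least n)

  S-periodic : ∀ n → Periodic (S n) (P x n)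
  S-periodic zero    (suc s) _ rewrite base (suc s) | base (suc s + 1) = refl
  S-periodic (suc n) s 1≤s = begin
    S (suc n) s                          ≡⟨ step n s ⟩
    sieveStep (S n) X s                  ≡⟨ sieveStep-periodic (S-periodic n) (x-≥2 n) s 1≤s ⟩
    sieveStep (S n) X (s + X * P x n)    ≡⟨ sym (step n _) ⟩
    S (suc n) (s + X * P x n)            ≡⟨ cong (λ m → S (suc n) (s + m)) (*-comm X (P x n)) ⟩
    S (suc n) (s + P x n * X)            ∎
    where
    open ≡-Reasoning
    X : ℕ
    X = x (suc n)

mainTheorem1 : (S : ℕ → Subset) (x : ℕ → ℕ) → ModelSieve S x →
    ∀ n → 1 ≤ n → ∀ s → 1 ≤ s → S n s ≡ S n (s + P x n)
mainTheorem1 S x M n _ = S-periodic M n
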